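{- Let $G=(V,E)$ be a graph with no universal vertices or true twins. Suppose there is a set $X\subseteq V$ such that (i) each vertex of $V\setminus X$ forms a circular pair with some vertex of $X$, and (ii) $G[X]$ admits a circular-arc representation that is normalized with respect to $G$. Then $G$ is a circular-arc graph.
   Context: Graphs are finite with a loop at every vertex; $N[u]$ is the closed neighbourhood. Universal vertex: $N[u]=V$; true twins: $N[u]=N[v]$. An edge $uv$ is an inclusion edge if $N[u],N[v]$ are comparable under inclusion, otherwise an overlap edge. $\{u,v\}$ is a spanning pair if every $x\in V\setminus N[v]$ has $N[x]\subseteq N[u]$ and every $y\in V\setminus N[u]$ has $N[y]\subseteq N[v]$. An overlap edge $uv$ is a 2-overlap edge if $\{u,v\}$ is a spanning pair. $\{u,v\}$ is a circular pair if it is a spanning pair and $uv\notin E$. A circular-arc representation of a graph assigns to each vertex $u$ an arc $[l_u,r_u]$ of a circle (clockwise from left endpoint $l_u$ to right endpoint $r_u$), all endpoints distinct, such that two vertices are adjacent iff their arcs intersect. A circular-arc representation $\{[l_u,r_u]\}_{u\in X}$ of $G[X]$ is normalized with respect to $G$ if for all $uv\in E$ with $u,v\in X$: (N1) $[l_u,r_u]$ properly contains $[l_v,r_v]$ iff $N[u]\supseteq N[v]$ in $G$; (N2) $[l_u,r_u]\cup[l_v,r_v]$ covers the circle iff $uv$ is a 2-overlap edge of $G$.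
   Formalization: The circle is taken as ℚ with one point at infinity, so the arcs of the circular-arc representations, of $G[X]$ and of G, have rational endpoints. -}

module Defs where

open import Data.Nat using (ℕ)
open import Data.Fin using (Fin)
open import Data.Fin.Subset using (Subset; _∈_; _∉_)
open import Data.Bool using (Bool; true)
open import Data.Rational using (ℚ; _≤_; _<_)
open import Data.Product using (Σ; _×_; ∃; ∃-syntax; _,_)
open import Data.Sum using (_⊎_)
open import Data.Unit using (⊤)
open import Relation.Nullary using (¬_)
open import Relation.Binary.PropositionalEquality using (_≡_; _≢_)
open import Function.Bundles using (_⇔_)

record Graph (n : ℕ) : Set where
  field
    adj     : Fin n → Fin n → Bool
    adj-sym : ∀ u v → adj u v ≡ adj v u
    adj-refl : ∀ u → adj u u ≡ true

module _ {n : ℕ} (G : Graph n) where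
  open Graph G

  E : Fin n → Fin n → Set
  E u v = adj u v ≡ true

  _⊆N_ : Fin n → Fin n → Set
  u ⊆N v = ∀ x → E u x → E v x

  Universal : Fin n → Set
  Universal u = ∀ x → E u x

  TrueTwins : Fin n → Fin n → Set
  TrueTwins u v = u ≢ v × (u ⊆N v) × (v ⊆N u)

  InclusionEdge : Fin n → Fin n → Set
  InclusionEdge u v = E u v × ((u ⊆N v) ⊎ (v ⊆N u))

  OverlapEdge : Fin n → Fin n → Set
  OverlapEdge u v = E u v × ¬ (u ⊆N v) × ¬ (v ⊆N u)

  SpanningPair : Fin n → Fin n → Set
  SpanningPair u v =
    (∀ x → ¬ E v x → x ⊆N u) × (∀ y → ¬ E u y → y ⊆N v)

  TwoOverlapEdge : Fin n → Fin n → Set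
  TwoOverlapEdge u v = OverlapEdge u v × SpanningPair u v

  CircularPair : Fin n → Fin n → Set
  CircularPair u v = SpanningPair u v × ¬ E u v

-- The circle is modelled by ℚ closed up by one point at
-- infinity (only finitely many endpoints occur, all in ℚ, so nothing is
-- lost by omitting the point at infinity: it belongs to exactly the same
-- arcs as any rational larger than all endpoints).  The arc [l,r] runs
-- clockwise (= increasing) from l to r, wrapping past infinity if r < l.

record Arc : Set where
  constructor [_,_]
  field
    l : ℚ
    r : ℚ
open Arc public

_∈A_ : ℚ → Arc → Set
x ∈A a = ((l a ≤ r a) × (l a ≤ x) × (x ≤ r a))
       ⊎ ((r a < l a) × ((l a ≤ x) ⊎ (x ≤ r a)))

Intersect : Arc → Arc → Set
Intersect a b = ∃[ x ] (x ∈A a × x ∈A b)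

ProperlyContains : Arc → Arc → Set
ProperlyContains a b = (∀ x → x ∈A b → x ∈A a) × (∃[ x ] (x ∈A a × ¬ (x ∈A b)))

CoversCircle : Arc → Arc → Set
CoversCircle a b = ∀ x → x ∈A a ⊎ x ∈A b

DistinctEndpoints : {n : ℕ} → (Fin n → Set) → (Fin n → Arc) → Set
DistinctEndpoints {n} S arc =
  (∀ u → S u → l (arc u) ≢ r (arc u)) ×
  (∀ u v → S u → S v → u ≢ v →
     (l (arc u) ≢ l (arc v)) × (r (arc u) ≢ r (arc v)) × (l (arc u) ≢ r (arc v)))

module _ {n : ℕ} (G : Graph n) where

  IsCARepOf : Subset n → (Fin n → Arc) → Set
  IsCARepOf X arc =
    DistinctEndpoints (_∈ X) arc ×
    (∀ u v → u ∈ X → v ∈ X → (E G u v ⇔ Intersect (arc u) (arc v)))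

  IsNormalized : Subset n → (Fin n → Arc) → Set
  IsNormalized X arc =
    ∀ u v → u ∈ X → v ∈ X → u ≢ v → E G u v →
      (ProperlyContains (arc u) (arc v) ⇔ (_⊆N_ G v u)) ×
      (CoversCircle (arc u) (arc v) ⇔ TwoOverlapEdge G u v)

  IsCircularArcGraph : Set
  IsCircularArcGraph =
    Σ (Fin n → Arc) λ arc →
      DistinctEndpoints (λ _ → ⊤) arc ×
      (∀ u v → (E G u v ⇔ Intersect (arc u) (arc v)))

-- Keep the arcs of X.  A vertex v outside X has a partner u ∈ X with {u, v}
-- circular, and gets the complement of the arc of u, shrunk at both ends by an
-- amount s v that is less than half of every gap between endpoints of the
-- representation of G[X] and differs from vertex to vertex.  Every new endpoint
-- then lies near exactly one old endpoint, so all endpoints are distinct and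
-- every intersection question is decided by the old endpoints.  Adjacency of a
-- vertex of X with one outside X is then read off with (N1), and adjacency of
-- two vertices outside X with (N2) and the spanning-pair conditions, the absence
-- of true twins excluding the one configuration these cannot settle.
module Submission where

open import Defs
open import Data.Nat as ℕ using (ℕ; zero; suc)
import Data.Nat.Properties as ℕ
open import Data.Fin using (Fin; zero; suc; toℕ)
open import Data.Fin.Properties using (_≟_; toℕ-injective)
open import Data.Fin.Subset using (Subset; _∈_; _∉_)
open import Data.Fin.Subset.Properties using (_∈?_)
open import Data.Bool using (true)
open import Data.Bool.Properties using () renaming (_≟_ to _≟ᵇ_)
open import Data.Rational using (ℚ; _≤_; _<_; _+_; _-_; -_; _*_; _⊓_; 0ℚ; 1ℚ; ½)
open import Data.Rational.Properties hiding (_≟_)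
open import Data.Rational.Solver using (module +-*-Solver)
open import Algebra.Properties.Group +-0-group using (∙-cancelˡ)
open import Data.Product using (Σ; _×_; ∃-syntax; _,_; proj₁; proj₂)
open import Data.Sum using (_⊎_; inj₁; inj₂; [_,_]′)
open import Data.Empty using (⊥-elim)
open import Relation.Nullary using (¬_; Dec; yes; no)
open import Relation.Nullary.Decidable using (_×-dec_; _⊎-dec_)
open import Relation.Binary.PropositionalEquality using (_≡_; _≢_; refl; sym; trans; cong; subst; ≢-sym)
open import Relation.Binary.Definitions using (tri<; tri≈; tri>)
open import Function.Bundles using (_⇔_; mk⇔; Equivalence)

<⇒≱ : ∀ {p q} → p < q → ¬ q ≤ p
<⇒≱ p<q q≤p = <-irrefl refl (<-≤-trans p<q q≤p)

p≤p+q : ∀ p {q} → 0ℚ ≤ q → p ≤ p + q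
p≤p+q p {q} 0≤q = subst (_≤ p + q) (+-identityʳ p) (+-monoʳ-≤ p 0≤q)

p<p+q : ∀ p {q} → 0ℚ < q → p < p + q
p<p+q p {q} 0<q = subst (_< p + q) (+-identityʳ p) (+-monoʳ-< p 0<q)

p-q<p : ∀ p {q} → 0ℚ < q → p - q < p
p-q<p p {q} 0<q = subst (p - q <_) (+-identityʳ p) (+-monoʳ-< p (neg-antimono-< 0<q))

p-q+q≡p : ∀ p q → p - q + q ≡ p
p-q+q≡p = solve 2 (λ p q → p :- q :+ q := p) refl
  where open +-*-Solver

p+[q+q]≤r⇒p+q≤r-q : ∀ p q {r} → p + (q + q) ≤ r → p + q ≤ r - q
p+[q+q]≤r⇒p+q≤r-q p q {r} ≤r =
  subst (_≤ r - q) (solve 2 (λ p q → p :+ (q :+ q) :- q := p :+ q) refl p q) (+-monoˡ-≤ (- q) ≤r)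
  where open +-*-Solver

half-pos : ∀ {p} → 0ℚ < p → 0ℚ < p * ½
half-pos {p} 0<p = subst (_< p * ½) (*-zeroˡ ½) (*-monoˡ-<-pos ½ 0<p)

half+half : ∀ p → p * ½ + p * ½ ≡ p
half+half p = trans (solve 2 (λ p h → p :* h :+ p :* h := p :* (h :+ h)) refl p ½) (*-identityʳ p)
  where open +-*-Solver

half< : ∀ {p} → 0ℚ < p → p * ½ < p
half< {p} 0<p = subst (p * ½ <_) (half+half p) (p<p+q (p * ½) (half-pos 0<p))

-- Positive lower bounds on finite sets

PositiveLowerBound : {A : Set} → (A → ℚ) → Set
PositiveLowerBound f = ∃[ m ] (0ℚ < m × ∀ a → m ≤ f a)

AdmitsPositiveLowerBounds : Set → Set
AdmitsPositiveLowerBounds A = (f : A → ℚ) → (∀ a → 0ℚ < f a) → PositiveLowerBound f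

⊓-pos : ∀ {p q} → 0ℚ < p → 0ℚ < q → 0ℚ < p ⊓ q
⊓-pos {p} {q} 0<p 0<q with ⊓-sel p q
... | inj₁ p⊓q≡p = subst (0ℚ <_) (sym p⊓q≡p) 0<p
... | inj₂ p⊓q≡q = subst (0ℚ <_) (sym p⊓q≡q) 0<q

Fin-admitsPositiveLowerBounds : ∀ k → AdmitsPositiveLowerBounds (Fin k)
Fin-admitsPositiveLowerBounds zero f _ = 1ℚ , positive⁻¹ 1ℚ , λ ()
Fin-admitsPositiveLowerBounds (suc k) f pos
  with Fin-admitsPositiveLowerBounds k (λ i → f (suc i)) (λ i → pos (suc i))
... | m , 0<m , m≤ = f zero ⊓ m , ⊓-pos (pos zero) 0<m , λ where
  zero    → p⊓q≤p (f zero) m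
  (suc i) → p≤q⇒r⊓p≤q (f zero) (m≤ i)

data Side : Set where
  left right : Side

Side-admitsPositiveLowerBounds : AdmitsPositiveLowerBounds Side
Side-admitsPositiveLowerBounds f pos = f left ⊓ f right , ⊓-pos (pos left) (pos right) , λ where
  left  → p⊓q≤p (f left) (f right)
  right → p⊓q≤q (f left) (f right)

,right≢,left : ∀ {A : Set} {x y : A} → (x , right) ≢ (y , left)
,right≢,left ()

×-admitsPositiveLowerBounds : ∀ {A B} → AdmitsPositiveLowerBounds A → AdmitsPositiveLowerBounds B →
                              AdmitsPositiveLowerBounds (A × B)
×-admitsPositiveLowerBounds boundA boundB f pos =
  let (m , 0<m , m≤) = boundA (λ a → proj₁ (inner a)) (λ a → proj₁ (proj₂ (inner a)))
  in  m , 0<m , λ (a , b) → ≤-trans (m≤ a) (proj₂ (proj₂ (inner a)) b)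
  where
  inner : ∀ a → PositiveLowerBound (λ b → f (a , b))
  inner a = boundB (λ b → f (a , b)) (λ b → pos (a , b))

-- Separated points and nearness

Near : ℚ → ℚ → ℚ → Set
Near ε a q = q ≤ a + ε × a ≤ q + ε

Separated : {I : Set} → ℚ → (I → ℚ) → Set
Separated ε x = ∀ i j → x i < x j → x i + (ε + ε) < x j

near-near⇒≤ : ∀ {ε q a b} → Near ε a q → Near ε b q → b ≤ a + (ε + ε)
near-near⇒≤ {ε} {q} {a} (q≤a+ε , _) (_ , b≤q+ε) =
  ≤-trans b≤q+ε (≤-trans (+-monoˡ-≤ ε q≤a+ε) (≤-reflexive (+-assoc a ε ε)))

near-unique : ∀ {I ε q} {x : I → ℚ} {i j} → Separated ε x →
              Near ε (x i) q → Near ε (x j) q → x i ≡ x j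
near-unique {x = x} {i} {j} sep near-i near-j with <-cmp (x i) (x j)
... | tri< xi<xj _ _ = ⊥-elim (<⇒≱ (sep i j xi<xj) (near-near⇒≤ near-i near-j))
... | tri≈ _ xi≡xj _ = xi≡xj
... | tri> _ _ xj<xi = ⊥-elim (<⇒≱ (sep j i xj<xi) (near-near⇒≤ near-j near-i))

near-refl : ∀ {ε} a → 0ℚ ≤ ε → Near ε a a
near-refl a 0≤ε = p≤p+q a 0≤ε , p≤p+q a 0≤ε

near-above : ∀ {ε s a q} → 0ℚ ≤ ε → s ≤ ε → a ≤ q → q ≤ a + s → Near ε a q
near-above {a = a} {q} 0≤ε s≤ε a≤q q≤a+s =
  ≤-trans q≤a+s (+-monoʳ-≤ a s≤ε) , ≤-trans a≤q (p≤p+q q 0≤ε)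

near-below : ∀ {ε s a q} → 0ℚ ≤ ε → s ≤ ε → a - s ≤ q → q ≤ a → Near ε a q
near-below {ε} {s} {a} {q} 0≤ε s≤ε a-s≤q q≤a =
  ≤-trans q≤a (p≤p+q a 0≤ε) ,
  ≤-trans (subst (_≤ q + s) (p-q+q≡p a s) (+-monoˡ-≤ s a-s≤q)) (+-monoʳ-≤ q s≤ε)

-- The value 1 for p ≮ q is junk; it only keeps gap positive.
gap : ℚ → ℚ → ℚ
gap p q with p <? q
... | yes _ = q - p
... | no _  = 1ℚ

gap-pos : ∀ p q → 0ℚ < gap p q
gap-pos p q with p <? q
... | yes p<q = subst (_< q - p) (+-inverseʳ p) (+-monoˡ-< (- p) p<q)
... | no _    = positive⁻¹ 1ℚ

p+gap≡q : ∀ {p q} → p < q → p + gap p q ≡ q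
p+gap≡q {p} {q} p<q with p <? q
... | yes _   = solve 2 (λ p q → p :+ (q :- p) := q) refl p q
  where open +-*-Solver
... | no p≮q = ⊥-elim (p≮q p<q)

quarter-separated : ∀ {I m} {x : I → ℚ} → 0ℚ < m → (∀ i j → m ≤ gap (x i) (x j)) →
                    Separated (m * ½ * ½) x
quarter-separated {m = m} {x} 0<m m≤gap i j xi<xj = begin-strict
  x i + (m * ½ * ½ + m * ½ * ½) ≡⟨ cong (x i +_) (half+half (m * ½)) ⟩
  x i + m * ½                   <⟨ +-monoʳ-< (x i) (half< 0<m) ⟩
  x i + m                       ≤⟨ +-monoʳ-≤ (x i) (m≤gap i j) ⟩
  x i + gap (x i) (x j)         ≡⟨ p+gap≡q xi<xj ⟩
  x j                           ∎
  where open ≤-Reasoning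

∃-separated : ∀ {I} (x : I → ℚ) → AdmitsPositiveLowerBounds (I × I) → ∃[ ε ] (0ℚ < ε × Separated ε x)
∃-separated x bounds with bounds (λ (i , j) → gap (x i) (x j)) (λ (i , j) → gap-pos (x i) (x j))
... | m , 0<m , m≤gap = m * ½ * ½ , half-pos (half-pos 0<m) , quarter-separated 0<m (λ i j → m≤gap (i , j))

halvings : ℕ → ℚ → ℚ
halvings zero    p = p
halvings (suc k) p = halvings k p * ½

halvings-pos : ∀ k {p} → 0ℚ < p → 0ℚ < halvings k p
halvings-pos zero    0<p = 0<p
halvings-pos (suc k) 0<p = half-pos (halvings-pos k 0<p)

halvings-≤ : ∀ k {p} → 0ℚ < p → halvings k p ≤ p
halvings-≤ zero    0<p = ≤-refl
halvings-≤ (suc k) 0<p = ≤-trans (<⇒≤ (half< (halvings-pos k 0<p))) (halvings-≤ k 0<p)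

halvings-decreasing : ∀ {i j p} → 0ℚ < p → i ℕ.< j → halvings j p < halvings i p
halvings-decreasing {i} {suc j} 0<p (ℕ.s≤s i≤j) with ℕ.m≤n⇒m<n∨m≡n i≤j
... | inj₁ i<j  = <-trans (half< (halvings-pos j 0<p)) (halvings-decreasing 0<p i<j)
... | inj₂ refl = half< (halvings-pos j 0<p)

∃-injective-shrinks : ∀ n {ε} → 0ℚ < ε →
  ∃[ s ] ((∀ v → 0ℚ < s v × s v ≤ ε) × (∀ {v w} → s v ≡ s w → v ≡ w))
∃-injective-shrinks n {ε} 0<ε =
  s , (λ v → halvings-pos (toℕ v) 0<ε , halvings-≤ (toℕ v) 0<ε) , injective
  where
  s : Fin n → ℚ
  s v = halvings (toℕ v) ε
  injective : ∀ {v w} → s v ≡ s w → v ≡ w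
  injective {v} {w} sv≡sw with ℕ.<-cmp (toℕ v) (toℕ w)
  ... | tri< v<w _ _ = ⊥-elim (<-irrefl (sym sv≡sw) (halvings-decreasing 0<ε v<w))
  ... | tri≈ _ v≡w _ = toℕ-injective v≡w
  ... | tri> _ _ w<v = ⊥-elim (<-irrefl sv≡sw (halvings-decreasing 0<ε w<v))

-- Arcs

infix 4 _∈[_,_] _⊆A_ _∈A?_

_∈[_,_] : ℚ → ℚ → ℚ → Set
x ∈[ p , q ] = p ≤ x × x ≤ q

_⊆A_ : Arc → Arc → Set
a ⊆A b = ∀ p → p ∈A a → p ∈A b

_∈A?_ : ∀ p a → Dec (p ∈A a)
p ∈A? [ l , r ] =
  ((l ≤? r) ×-dec ((l ≤? p) ×-dec (p ≤? r))) ⊎-dec ((r <? l) ×-dec ((l ≤? p) ⊎-dec (p ≤? r)))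

left-∈A : ∀ a → l a ∈A a
left-∈A a with l a ≤? r a
... | yes l≤r = inj₁ (l≤r , ≤-refl , l≤r)
... | no  l≰r = inj₂ (≰⇒> l≰r , inj₁ ≤-refl)

right-∈A : ∀ a → r a ∈A a
right-∈A a with l a ≤? r a
... | yes l≤r = inj₁ (l≤r , l≤r , ≤-refl)
... | no  l≰r = inj₂ (≰⇒> l≰r , inj₂ ≤-refl)

-- b runs from just after the right end of a to just before its left end; by the
-- last conjunct, b does not wrap around infinity when a does.
_InGapOf_ : Arc → Arc → Set
b InGapOf a = r a < l b × r b < l a × (r a < l a → l b ≤ r b)

inGap-disjoint : ∀ {a b p} → b InGapOf a → p ∈A b → ¬ p ∈A a
inGap-disjoint (ra<lb , rb<la , _) (inj₁ (_ , lb≤p , p≤rb)) (inj₁ (_ , _ , p≤ra)) =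
  <⇒≱ ra<lb (≤-trans lb≤p p≤ra)
inGap-disjoint (_ , rb<la , _) (inj₁ (_ , _ , p≤rb)) (inj₂ (_ , inj₁ la≤p)) =
  <⇒≱ rb<la (≤-trans la≤p p≤rb)
inGap-disjoint (ra<lb , _ , _) (inj₁ (_ , lb≤p , _)) (inj₂ (_ , inj₂ p≤ra)) =
  <⇒≱ ra<lb (≤-trans lb≤p p≤ra)
inGap-disjoint (ra<lb , _ , _) (inj₂ (_ , inj₁ lb≤p)) (inj₁ (_ , _ , p≤ra)) =
  <⇒≱ ra<lb (≤-trans lb≤p p≤ra)
inGap-disjoint (_ , rb<la , _) (inj₂ (_ , inj₂ p≤rb)) (inj₁ (_ , la≤p , _)) =
  <⇒≱ rb<la (≤-trans la≤p p≤rb)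
inGap-disjoint (_ , _ , noWrap) (inj₂ (rb<lb , _)) (inj₂ (ra<la , _)) =
  <⇒≱ rb<lb (noWrap ra<la)

∉A⇒∈inGap⊎slack : ∀ {a b p} → b InGapOf a → ¬ p ∈A a →
                  p ∈A b ⊎ p ∈[ r a , l b ] ⊎ p ∈[ r b , l a ]
∉A⇒∈inGap⊎slack {a} {b} {p} (ra<lb , rb<la , noWrap) p∉a with l a ≤? r a
... | yes la≤ra = bWraps (<-trans rb<la (≤-<-trans la≤ra ra<lb))
  where
  bWraps : r b < l b → p ∈A b ⊎ p ∈[ r a , l b ] ⊎ p ∈[ r b , l a ]
  bWraps rb<lb with l a ≤? p | p ≤? r a | l b ≤? p | p ≤? r b
  ... | yes la≤p | yes p≤ra | _        | _        = ⊥-elim (p∉a (inj₁ (la≤ra , la≤p , p≤ra)))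
  ... | no  la≰p | _        | _        | yes p≤rb = inj₁ (inj₂ (rb<lb , inj₂ p≤rb))
  ... | no  la≰p | _        | _        | no  p≰rb = inj₂ (inj₂ (<⇒≤ (≰⇒> p≰rb) , <⇒≤ (≰⇒> la≰p)))
  ... | yes _    | no  _    | yes lb≤p | _        = inj₁ (inj₂ (rb<lb , inj₁ lb≤p))
  ... | yes _    | no  p≰ra | no  lb≰p | _        = inj₂ (inj₁ (<⇒≤ (≰⇒> p≰ra) , <⇒≤ (≰⇒> lb≰p)))
... | no la≰ra = aWraps (≰⇒> la≰ra)
  where
  aWraps : r a < l a → p ∈A b ⊎ p ∈[ r a , l b ] ⊎ p ∈[ r b , l a ]
  aWraps ra<la with l a ≤? p | p ≤? r a | l b ≤? p | p ≤? r b
  ... | yes la≤p | _        | _        | _        = ⊥-elim (p∉a (inj₂ (ra<la , inj₁ la≤p)))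
  ... | no  _    | yes p≤ra | _        | _        = ⊥-elim (p∉a (inj₂ (ra<la , inj₂ p≤ra)))
  ... | no  _    | no  p≰ra | no  lb≰p | _        = inj₂ (inj₁ (<⇒≤ (≰⇒> p≰ra) , <⇒≤ (≰⇒> lb≰p)))
  ... | no  _    | no  _    | yes lb≤p | yes p≤rb = inj₁ (inj₁ (noWrap ra<la , lb≤p , p≤rb))
  ... | no  la≰p | no  _    | yes _    | no  p≰rb = inj₂ (inj₂ (<⇒≤ (≰⇒> p≰rb) , <⇒≤ (≰⇒> la≰p)))

∈A-slideˡ : ∀ {a p q} → p ≤ q → ¬ l a ∈[ p , q ] → ¬ r a ∈[ p , q ] → q ∈A a → p ∈A a
∈A-slideˡ {a} {p} p≤q la∉ ra∉ (inj₁ (la≤ra , la≤q , q≤ra)) with l a ≤? p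
... | yes la≤p = inj₁ (la≤ra , la≤p , ≤-trans p≤q q≤ra)
... | no  la≰p = ⊥-elim (la∉ (<⇒≤ (≰⇒> la≰p) , la≤q))
∈A-slideˡ p≤q la∉ ra∉ (inj₂ (ra<la , inj₂ q≤ra)) = inj₂ (ra<la , inj₂ (≤-trans p≤q q≤ra))
∈A-slideˡ {a} {p} p≤q la∉ ra∉ (inj₂ (ra<la , inj₁ la≤q)) with l a ≤? p
... | yes la≤p = inj₂ (ra<la , inj₁ la≤p)
... | no  la≰p = ⊥-elim (la∉ (<⇒≤ (≰⇒> la≰p) , la≤q))

ends-∈A⇒⊆A : ∀ {a b} → l b ∈A a → r b ∈A a → ¬ l a ∈A b → b ⊆A a
ends-∈A⇒⊆A (inj₁ (la≤ra , la≤lb , _)) (inj₁ (_ , _ , rb≤ra)) _ p (inj₁ (_ , lb≤p , p≤rb)) =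
  inj₁ (la≤ra , ≤-trans la≤lb lb≤p , ≤-trans p≤rb rb≤ra)
ends-∈A⇒⊆A (inj₁ _) (inj₁ (_ , la≤rb , _)) la∉b _ (inj₂ (rb<lb , _)) =
  ⊥-elim (la∉b (inj₂ (rb<lb , inj₂ la≤rb)))
ends-∈A⇒⊆A (inj₁ (la≤ra , _)) (inj₂ (ra<la , _)) _ _ _ = ⊥-elim (<⇒≱ ra<la la≤ra)
ends-∈A⇒⊆A (inj₂ (ra<la , _)) (inj₁ (la≤ra , _)) _ _ _ = ⊥-elim (<⇒≱ ra<la la≤ra)
ends-∈A⇒⊆A (inj₂ (ra<la , inj₁ la≤lb)) (inj₂ _) _ p (inj₁ (_ , lb≤p , _)) =
  inj₂ (ra<la , inj₁ (≤-trans la≤lb lb≤p))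
ends-∈A⇒⊆A (inj₂ (ra<la , inj₂ lb≤ra)) (inj₂ (_ , inj₂ rb≤ra)) _ p (inj₁ (_ , _ , p≤rb)) =
  inj₂ (ra<la , inj₂ (≤-trans p≤rb rb≤ra))
ends-∈A⇒⊆A (inj₂ (ra<la , inj₂ lb≤ra)) (inj₂ (_ , inj₁ la≤rb)) la∉b _ (inj₁ (lb≤rb , _)) =
  ⊥-elim (la∉b (inj₁ (lb≤rb , <⇒≤ (≤-<-trans lb≤ra ra<la) , la≤rb)))
ends-∈A⇒⊆A (inj₂ (ra<la , inj₁ la≤lb)) (inj₂ _) _ p (inj₂ (_ , inj₁ lb≤p)) =
  inj₂ (ra<la , inj₁ (≤-trans la≤lb lb≤p))
ends-∈A⇒⊆A (inj₂ (ra<la , inj₂ lb≤ra)) (inj₂ _) la∉b _ (inj₂ (rb<lb , inj₁ _)) =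
  ⊥-elim (la∉b (inj₂ (rb<lb , inj₁ (<⇒≤ (≤-<-trans lb≤ra ra<la)))))
ends-∈A⇒⊆A (inj₂ (ra<la , _)) (inj₂ (_ , inj₂ rb≤ra)) _ p (inj₂ (_ , inj₂ p≤rb)) =
  inj₂ (ra<la , inj₂ (≤-trans p≤rb rb≤ra))
ends-∈A⇒⊆A (inj₂ _) (inj₂ (_ , inj₁ la≤rb)) la∉b _ (inj₂ (rb<lb , inj₂ _)) =
  ⊥-elim (la∉b (inj₂ (rb<lb , inj₂ la≤rb)))

rights-crossing⇒covers : ∀ {a b} → r a ∈A b → r b ∈A a → r a ≢ r b → CoversCircle a b
rights-crossing⇒covers {a} {b} ra∈b rb∈a ra≢rb p with p ∈A? a
... | yes p∈a = inj₁ p∈a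
... | no  p∉a = inj₂ (cover ra∈b rb∈a)
  where
  absurd-antisym : ∀ {A : Set} → r a ≤ r b → r b ≤ r a → A
  absurd-antisym ra≤rb rb≤ra = ⊥-elim (ra≢rb (≤-antisym ra≤rb rb≤ra))
  cover : r a ∈A b → r b ∈A a → p ∈A b
  cover (inj₁ (_ , _ , ra≤rb)) (inj₁ (_ , _ , rb≤ra)) = absurd-antisym ra≤rb rb≤ra
  cover (inj₂ (_ , inj₂ ra≤rb)) (inj₁ (_ , _ , rb≤ra)) = absurd-antisym ra≤rb rb≤ra
  cover (inj₂ (rb<lb , inj₁ lb≤ra)) (inj₁ (la≤ra , la≤rb , _)) with l a ≤? p | p ≤? r a
  ... | yes la≤p | yes p≤ra = ⊥-elim (p∉a (inj₁ (la≤ra , la≤p , p≤ra)))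
  ... | no  la≰p | _        = inj₂ (rb<lb , inj₂ (≤-trans (<⇒≤ (≰⇒> la≰p)) la≤rb))
  ... | yes _    | no  p≰ra = inj₂ (rb<lb , inj₁ (≤-trans lb≤ra (<⇒≤ (≰⇒> p≰ra))))
  cover ra∈b (inj₂ (ra<la , rb∈a)) with l a ≤? p | p ≤? r a
  ... | yes la≤p | _        = ⊥-elim (p∉a (inj₂ (ra<la , inj₁ la≤p)))
  ... | no  _    | yes p≤ra = ⊥-elim (p∉a (inj₂ (ra<la , inj₂ p≤ra)))
  ... | no  la≰p | no  p≰ra = between ra∈b rb∈a
    where
    p<la : p < l a
    p<la = ≰⇒> la≰p
    ra<p : r a < p
    ra<p = ≰⇒> p≰ra
    between : r a ∈A b → (l a ≤ r b ⊎ r b ≤ r a) → p ∈A b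
    between (inj₁ (lb≤rb , lb≤ra , _)) (inj₁ la≤rb) =
      inj₁ (lb≤rb , ≤-trans lb≤ra (<⇒≤ ra<p) , ≤-trans (<⇒≤ p<la) la≤rb)
    between (inj₂ (rb<lb , inj₁ lb≤ra)) (inj₁ la≤rb) =
      ⊥-elim (<⇒≱ rb<lb (≤-trans lb≤ra (≤-trans (<⇒≤ ra<la) la≤rb)))
    between (inj₂ (rb<lb , inj₂ _)) (inj₁ la≤rb) = inj₂ (rb<lb , inj₂ (≤-trans (<⇒≤ p<la) la≤rb))
    between (inj₁ (_ , _ , ra≤rb)) (inj₂ rb≤ra) = absurd-antisym ra≤rb rb≤ra
    between (inj₂ (_ , inj₂ ra≤rb)) (inj₂ rb≤ra) = absurd-antisym ra≤rb rb≤ra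
    between (inj₂ (rb<lb , inj₁ lb≤ra)) (inj₂ _) = inj₂ (rb<lb , inj₁ (≤-trans lb≤ra (<⇒≤ ra<p)))

-- Circular pairs

module _ {n : ℕ} (G : Graph n) where
  open Graph G

  E? : ∀ u v → Dec (E G u v)
  E? u v = adj u v ≟ᵇ true

  E-sym : ∀ {u v} → E G u v → E G v u
  E-sym {u} {v} = trans (adj-sym v u)

  circular⇒⊆N : ∀ {u v x} → CircularPair G u v → ¬ E G x v → _⊆N_ G x u
  circular⇒⊆N ((v-far⇒⊆u , _) , _) x≁v = v-far⇒⊆u _ (λ vx → x≁v (E-sym vx))

  circular-samePartner⇒E : ∀ {u v w} → CircularPair G u v → CircularPair G u w → E G v w
  circular-samePartner⇒E ((_ , u-far⇒⊆v) , _) (_ , u≁w) = u-far⇒⊆v _ u≁w _ (adj-refl _)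

  circular-nonadjacentPartners⇒E : ∀ {u v u' w} → (∀ a b → ¬ TrueTwins G a b) → v ≢ u' →
    CircularPair G u v → CircularPair G u' w → ¬ E G u u' → E G v w
  circular-nonadjacentPartners⇒E {v = v} {u'} {w} noTwins v≢u' ((_ , u-far⇒⊆v) , _) cp' u≁u'
    with E? v w
  ... | yes v∼w = v∼w
  ... | no  v≁w = ⊥-elim (noTwins v u' (v≢u' , circular⇒⊆N cp' v≁w , u-far⇒⊆v u' u≁u'))

  circular-adjacent⇒¬spanning : ∀ {u v u' w} → CircularPair G u v → CircularPair G u' w →
    E G v w → ¬ SpanningPair G u u'
  circular-adjacent⇒¬spanning (_ , u≁v) (_ , u'≁w) v∼w (_ , u-far⇒⊆u') = u'≁w (u-far⇒⊆u' _ u≁v _ v∼w)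

  circular-nonadjacent⇒twoOverlap : ∀ {u v u' w} → CircularPair G u v → CircularPair G u' w →
    ¬ E G v w → E G u u' → TwoOverlapEdge G u u'
  circular-nonadjacent⇒twoOverlap {u} {v} {u'} {w} cp@((_ , u-far⇒⊆v) , u≁v) cp'@((_ , u'-far⇒⊆w) , u'≁w) v≁w u∼u' =
    (u∼u' , u⊈u' , u'⊈u) , spanning
    where
    w⊆u : _⊆N_ G w u
    w⊆u = circular⇒⊆N cp (λ wv → v≁w (E-sym wv))
    v⊆u' : _⊆N_ G v u'
    v⊆u' = circular⇒⊆N cp' v≁w
    spanning : SpanningPair G u u'
    spanning = (λ x u'≁x y xy → w⊆u y (u'-far⇒⊆w x u'≁x y xy))
             , (λ x u≁x y xy → v⊆u' y (u-far⇒⊆v x u≁x y xy))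
    u⊈u' : ¬ _⊆N_ G u u'
    u⊈u' u⊆u' = u'≁w (u⊆u' w (w⊆u w (adj-refl w)))
    u'⊈u : ¬ _⊆N_ G u' u
    u'⊈u u'⊆u = u≁v (u'⊆u v (v⊆u' v (adj-refl v)))

-- Shrunken complements of the arcs of partners

module Construction {n : ℕ} (G : Graph n) (X : Subset n) (arc : Fin n → Arc)
  (distinct : DistinctEndpoints (_∈ X) arc)
  (represents : ∀ u v → u ∈ X → v ∈ X → (E G u v ⇔ Intersect (arc u) (arc v)))
  (normalized : IsNormalized G X arc) where

  end : Fin n × Side → ℚ
  end (x , left)  = l (arc x)
  end (x , right) = r (arc x)

  end-injective : ∀ {x y b c} → x ∈ X → y ∈ X → end (x , b) ≡ end (y , c) → (x , b) ≡ (y , c)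
  end-injective {x} {y} x∈X y∈X eq with x ≟ y
  end-injective {b = left}  {left}  _   _ eq | yes refl = refl
  end-injective {b = right} {right} _   _ eq | yes refl = refl
  end-injective {x} {b = left}  {right} x∈X _ eq | yes refl = ⊥-elim (proj₁ distinct x x∈X eq)
  end-injective {x} {b = right} {left}  x∈X _ eq | yes refl = ⊥-elim (proj₁ distinct x x∈X (sym eq))
  end-injective {x} {y} {left}  {left}  x∈X y∈X eq | no x≢y =
    ⊥-elim (proj₁ (proj₂ distinct x y x∈X y∈X x≢y) eq)
  end-injective {x} {y} {right} {right} x∈X y∈X eq | no x≢y =
    ⊥-elim (proj₁ (proj₂ (proj₂ distinct x y x∈X y∈X x≢y)) eq)
  end-injective {x} {y} {left}  {right} x∈X y∈X eq | no x≢y =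
    ⊥-elim (proj₂ (proj₂ (proj₂ distinct x y x∈X y∈X x≢y)) eq)
  end-injective {x} {y} {right} {left}  x∈X y∈X eq | no x≢y =
    ⊥-elim (proj₂ (proj₂ (proj₂ distinct y x y∈X x∈X (≢-sym x≢y))) (sym eq))

  private
    endpointPairs-bounded : AdmitsPositiveLowerBounds ((Fin n × Side) × (Fin n × Side))
    endpointPairs-bounded = ×-admitsPositiveLowerBounds endpoints-bounded endpoints-bounded
      where
      endpoints-bounded : AdmitsPositiveLowerBounds (Fin n × Side)
      endpoints-bounded = ×-admitsPositiveLowerBounds (Fin-admitsPositiveLowerBounds n) Side-admitsPositiveLowerBounds

  -- ε and s are only used through their properties; unfolding them is very costly.
  abstract
    separation : ∃[ ε ] (0ℚ < ε × Separated ε end)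
    separation = ∃-separated end endpointPairs-bounded

  ε : ℚ
  ε = proj₁ separation

  0≤ε : 0ℚ ≤ ε
  0≤ε = <⇒≤ (proj₁ (proj₂ separation))

  separated : Separated ε end
  separated = proj₂ (proj₂ separation)

  snap : ∀ {x y b c q q'} → x ∈ X → y ∈ X →
         Near ε (end (x , b)) q → Near ε (end (y , c)) q' → q ≡ q' → (x , b) ≡ (y , c)
  snap {x} {y} {b} {c} x∈X y∈X near near' refl =
    end-injective x∈X y∈X (near-unique {i = x , b} {j = y , c} separated near near')

  abstract
    shrinks : Σ (Fin n → ℚ) λ s → ((∀ v → 0ℚ < s v × s v ≤ ε) × (∀ {v w} → s v ≡ s w → v ≡ w))
    shrinks = ∃-injective-shrinks n (proj₁ (proj₂ separation))

  s : Fin n → ℚ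
  s = proj₁ shrinks

  0<s : ∀ v → 0ℚ < s v
  0<s v = proj₁ (proj₁ (proj₂ shrinks) v)

  s≤ε : ∀ v → s v ≤ ε
  s≤ε v = proj₂ (proj₁ (proj₂ shrinks) v)

  s-injective : ∀ {v w} → s v ≡ s w → v ≡ w
  s-injective = proj₂ (proj₂ shrinks)

  coArc : Fin n → Fin n → Arc
  coArc u v = [ r (arc u) + s v , l (arc u) - s v ]

  coArc-inGap : ∀ u v → coArc u v InGapOf arc u
  coArc-inGap u v = p<p+q (r (arc u)) (0<s v) , p-q<p (l (arc u)) (0<s v) , noWrap
    where
    noWrap : r (arc u) < l (arc u) → r (arc u) + s v ≤ l (arc u) - s v
    noWrap ru<lu = p+[q+q]≤r⇒p+q≤r-q (r (arc u)) (s v) (<⇒≤ (begin-strict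
      r (arc u) + (s v + s v) ≤⟨ +-monoʳ-≤ (r (arc u)) (+-mono-≤ (s≤ε v) (s≤ε v)) ⟩
      r (arc u) + (ε + ε)     <⟨ separated (u , right) (u , left) ru<lu ⟩
      l (arc u)               ∎))
      where open ≤-Reasoning

  rightSlack-near : ∀ u v {q} → q ∈[ r (arc u) , l (coArc u v) ] → Near ε (end (u , right)) q
  rightSlack-near u v (ru≤q , q≤ru+s) = near-above 0≤ε (s≤ε v) ru≤q q≤ru+s

  leftSlack-near : ∀ u v {q} → q ∈[ r (coArc u v) , l (arc u) ] → Near ε (end (u , left)) q
  leftSlack-near u v (lu-s≤q , q≤lu) = near-below 0≤ε (s≤ε v) lu-s≤q q≤lu

  coArc-left-near : ∀ u v → Near ε (end (u , right)) (l (coArc u v))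
  coArc-left-near u v = rightSlack-near u v (<⇒≤ (p<p+q (r (arc u)) (0<s v)) , ≤-refl)

  coArc-right-near : ∀ u v → Near ε (end (u , left)) (r (coArc u v))
  coArc-right-near u v = leftSlack-near u v (≤-refl , <⇒≤ (p-q<p (l (arc u)) (0<s v)))

  end-near : ∀ x b → Near ε (end (x , b)) (end (x , b))
  end-near x b = near-refl (end (x , b)) 0≤ε

  rightSlack-avoids : ∀ {x u} v b {q} → x ∈ X → u ∈ X → x ≢ u →
    Near ε (end (x , b)) q → ¬ q ∈[ r (arc u) , l (coArc u v) ]
  rightSlack-avoids {u = u} v b x∈X u∈X x≢u near q∈slack =
    x≢u (cong proj₁ (snap {b = b} {right} x∈X u∈X near (rightSlack-near u v q∈slack) refl))

  leftSlack-avoids : ∀ {x u} v b {q} → x ∈ X → u ∈ X → x ≢ u →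
    Near ε (end (x , b)) q → ¬ q ∈[ r (coArc u v) , l (arc u) ]
  leftSlack-avoids {u = u} v b x∈X u∈X x≢u near q∈slack =
    x≢u (cong proj₁ (snap {b = b} {left} x∈X u∈X near (leftSlack-near u v q∈slack) refl))

  ∉A⇒∈coArc : ∀ {x u} v b {q} → x ∈ X → u ∈ X → x ≢ u →
    Near ε (end (x , b)) q → ¬ q ∈A arc u → q ∈A coArc u v
  ∉A⇒∈coArc {u = u} v b {q} x∈X u∈X x≢u near q∉u = inCoArc (∉A⇒∈inGap⊎slack (coArc-inGap u v) q∉u)
    where
    inCoArc : q ∈A coArc u v ⊎ q ∈[ r (arc u) , l (coArc u v) ] ⊎ q ∈[ r (coArc u v) , l (arc u) ] →
              q ∈A coArc u v
    inCoArc (inj₁ q∈coArc)         = q∈coArc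
    inCoArc (inj₂ (inj₁ q∈slack)) = ⊥-elim (rightSlack-avoids v b x∈X u∈X x≢u near q∈slack)
    inCoArc (inj₂ (inj₂ q∈slack)) = ⊥-elim (leftSlack-avoids v b x∈X u∈X x≢u near q∈slack)

  ∈A-retreat-rightSlack : ∀ {x u} v → x ∈ X → u ∈ X → x ≢ u →
    l (coArc u v) ∈A arc x → r (arc u) ∈A arc x
  ∈A-retreat-rightSlack {x} {u} v x∈X u∈X x≢u =
    ∈A-slideˡ (<⇒≤ (p<p+q (r (arc u)) (0<s v)))
      (rightSlack-avoids v left x∈X u∈X x≢u (end-near x left))
      (rightSlack-avoids v right x∈X u∈X x≢u (end-near x right))

  ∈A-retreat-leftSlack : ∀ {x u} v → x ∈ X → u ∈ X → x ≢ u →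
    l (arc u) ∈A arc x → r (coArc u v) ∈A arc x
  ∈A-retreat-leftSlack {x} {u} v x∈X u∈X x≢u =
    ∈A-slideˡ (<⇒≤ (p-q<p (l (arc u)) (0<s v)))
      (leftSlack-avoids v left x∈X u∈X x≢u (end-near x left))
      (leftSlack-avoids v right x∈X u∈X x≢u (end-near x right))

  arcs-meet⇒E : ∀ {x y} → x ∈ X → y ∈ X → Intersect (arc x) (arc y) → E G x y
  arcs-meet⇒E x∈X y∈X = Equivalence.from (represents _ _ x∈X y∈X)

  E⇒meets-coArc : ∀ {x u v} → x ∈ X → u ∈ X → CircularPair G u v →
    E G x v → Intersect (arc x) (coArc u v)
  E⇒meets-coArc {x} {u} {v} x∈X u∈X cp x∼v with x ≟ u
  ... | yes refl = ⊥-elim (proj₂ cp x∼v)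
  ... | no x≢u with l (arc x) ∈A? arc u | r (arc x) ∈A? arc u
  ...   | no lx∉u | _ = l (arc x) , left-∈A (arc x) , ∉A⇒∈coArc v left x∈X u∈X x≢u (end-near x left) lx∉u
  ...   | yes _ | no rx∉u = r (arc x) , right-∈A (arc x) , ∉A⇒∈coArc v right x∈X u∈X x≢u (end-near x right) rx∉u
  ...   | yes lx∈u | yes rx∈u with l (arc u) ∈A? arc x
  ...     | yes lu∈x = r (coArc u v) , ∈A-retreat-leftSlack v x∈X u∈X x≢u lu∈x , right-∈A (coArc u v)
  ...     | no lu∉x = ⊥-elim (proj₂ cp (x⊆u v x∼v))
    where
    -- arc u properly contains arc x, so (N1) gives N[x] ⊆ N[u], which misses v
    x⊆u : _⊆N_ G x u
    x⊆u = Equivalence.to (proj₁ (normalized u x u∈X x∈X (≢-sym x≢u)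
            (arcs-meet⇒E u∈X x∈X (l (arc x) , lx∈u , left-∈A (arc x)))))
            (ends-∈A⇒⊆A lx∈u rx∈u lu∉x , l (arc u) , left-∈A (arc u) , lu∉x)

  meets-coArc⇒E : ∀ {x u v} → x ∈ X → u ∈ X → CircularPair G u v →
    Intersect (arc x) (coArc u v) → E G x v
  meets-coArc⇒E {x} {u} {v} x∈X u∈X cp (p , p∈x , p∈coArc) with E? G x v
  ... | yes x∼v = x∼v
  ... | no  x≁v = ⊥-elim (inGap-disjoint (coArc-inGap u v) p∈coArc (p∈u (x ≟ u)))
    where
    x⊆u : _⊆N_ G x u
    x⊆u = circular⇒⊆N G cp x≁v
    p∈u : Dec (x ≡ u) → p ∈A arc u
    p∈u (yes refl) = p∈x
    p∈u (no x≢u) = proj₁ (Equivalence.from (proj₁ (normalized u x u∈X x∈X (≢-sym x≢u)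
                     (x⊆u x (Graph.adj-refl G x)))) x⊆u) p p∈x

  meets-sym : ∀ {a b} → Intersect a b → Intersect b a
  meets-sym (p , p∈a , p∈b) = p , p∈b , p∈a

  coArcs-meet⇒E : ∀ {u v u' w} → (∀ a b → ¬ TrueTwins G a b) → u ∈ X → u' ∈ X → v ≢ u' →
    CircularPair G u v → CircularPair G u' w → Intersect (coArc u v) (coArc u' w) → E G v w
  coArcs-meet⇒E {u} {v} {u'} {w} noTwins u∈X u'∈X v≢u' cp cp' (p , p∈v , p∈w) with E? G v w
  ... | yes v∼w = v∼w
  ... | no  v≁w with u ≟ u'
  ...   | yes refl = ⊥-elim (v≁w (circular-samePartner⇒E G cp cp'))
  ...   | no  u≢u' with E? G u u'
  ...     | no  u≁u' = ⊥-elim (v≁w (circular-nonadjacentPartners⇒E G noTwins v≢u' cp cp' u≁u'))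
  ...     | yes u∼u' = ⊥-elim ([ inGap-disjoint (coArc-inGap u v) p∈v
                             , inGap-disjoint (coArc-inGap u' w) p∈w ]′ (covers p))
    where
    covers : CoversCircle (arc u) (arc u')
    covers = Equivalence.from (proj₂ (normalized u u' u∈X u'∈X u≢u' u∼u'))
               (circular-nonadjacent⇒twoOverlap G cp cp' v≁w u∼u')

  coArcs-samePartner-meet : ∀ {u v w} → u ∈ X → s v < s w → Intersect (coArc u v) (coArc u w)
  coArcs-samePartner-meet {u} {v} {w} u∈X sv<sw =
    q , inCoArc (∉A⇒∈inGap⊎slack (coArc-inGap u v) (inGap-disjoint (coArc-inGap u w) (left-∈A (coArc u w)))) ,
    left-∈A (coArc u w)
    where
    q : ℚ
    q = l (coArc u w)
    inCoArc : q ∈A coArc u v ⊎ q ∈[ r (arc u) , l (coArc u v) ] ⊎ q ∈[ r (coArc u v) , l (arc u) ] →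
              q ∈A coArc u v
    inCoArc (inj₁ q∈v)            = q∈v
    inCoArc (inj₂ (inj₁ (_ , q≤lv))) = ⊥-elim (<⇒≱ (+-monoʳ-< (r (arc u)) sv<sw) q≤lv)
    inCoArc (inj₂ (inj₂ q∈slack)) =
      ⊥-elim (,right≢,left (snap u∈X u∈X (coArc-left-near u w) (leftSlack-near u v q∈slack) refl))

  E⇒coArcs-meet : ∀ {u v u' w} → u ∈ X → u' ∈ X → v ≢ w →
    CircularPair G u v → CircularPair G u' w → E G v w → Intersect (coArc u v) (coArc u' w)
  E⇒coArcs-meet {u} {v} {u'} {w} u∈X u'∈X v≢w cp cp' v∼w with u ≟ u'
  ... | yes refl with <-cmp (s v) (s w)
  ...   | tri< sv<sw _ _ = coArcs-samePartner-meet u∈X sv<sw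
  ...   | tri≈ _ sv≡sw _ = ⊥-elim (v≢w (s-injective sv≡sw))
  ...   | tri> _ _ sw<sv = meets-sym (coArcs-samePartner-meet u∈X sw<sv)
  E⇒coArcs-meet {u} {v} {u'} {w} u∈X u'∈X v≢w cp cp' v∼w | no u≢u'
    with l (coArc u v) ∈A? arc u' | l (coArc u' w) ∈A? arc u
  ... | no lv∉u' | _ =
    l (coArc u v) , left-∈A (coArc u v) , ∉A⇒∈coArc w right u∈X u'∈X u≢u' (coArc-left-near u v) lv∉u'
  ... | yes _ | no lw∉u =
    meets-sym (l (coArc u' w) , left-∈A (coArc u' w) ,
               ∉A⇒∈coArc v right u'∈X u∈X (≢-sym u≢u') (coArc-left-near u' w) lw∉u)
  ... | yes lv∈u' | yes lw∈u = ⊥-elim (circular-adjacent⇒¬spanning G cp cp' v∼w (proj₂ twoOverlap))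
    where
    -- each right end of arc u, arc u' lies on the other arc, so by (N2) uu' is a 2-overlap edge
    ru∈u' : r (arc u) ∈A arc u'
    ru∈u' = ∈A-retreat-rightSlack v u'∈X u∈X (≢-sym u≢u') lv∈u'
    ru'∈u : r (arc u') ∈A arc u
    ru'∈u = ∈A-retreat-rightSlack w u∈X u'∈X u≢u' lw∈u
    ru≢ru' : r (arc u) ≢ r (arc u')
    ru≢ru' ru≡ru' = u≢u' (cong proj₁ (end-injective {b = right} {right} u∈X u'∈X ru≡ru'))
    twoOverlap : TwoOverlapEdge G u u'
    twoOverlap = Equivalence.to (proj₂ (normalized u u' u∈X u'∈X u≢u'
                   (arcs-meet⇒E u∈X u'∈X (r (arc u) , right-∈A (arc u) , ru∈u'))))
                   (rights-crossing⇒covers ru∈u' ru'∈u ru≢ru')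

  end≢l-coArc : ∀ {x u} b v → x ∈ X → u ∈ X → end (x , b) ≢ l (coArc u v)
  end≢l-coArc {x} {u} b v x∈X u∈X eq =
    differ (snap {b = b} {right} x∈X u∈X (end-near x b) (coArc-left-near u v) eq) eq
    where
    differ : ∀ {y c} → (y , c) ≡ (u , right) → end (y , c) ≢ l (coArc u v)
    differ refl eq' = <-irrefl eq' (p<p+q (r (arc u)) (0<s v))

  end≢r-coArc : ∀ {x u} b v → x ∈ X → u ∈ X → end (x , b) ≢ r (coArc u v)
  end≢r-coArc {x} {u} b v x∈X u∈X eq =
    differ (snap {b = b} {left} x∈X u∈X (end-near x b) (coArc-right-near u v) eq) eq
    where
    differ : ∀ {y c} → (y , c) ≡ (u , left) → end (y , c) ≢ r (coArc u v)
    differ refl eq' = <-irrefl (sym eq') (p-q<p (l (arc u)) (0<s v))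

  l-coArc-injective : ∀ {u u' v w} → u ∈ X → u' ∈ X → l (coArc u v) ≡ l (coArc u' w) → v ≡ w
  l-coArc-injective {u} {u'} {v} {w} u∈X u'∈X eq =
    cancel (snap {b = right} {right} u∈X u'∈X (coArc-left-near u v) (coArc-left-near u' w) eq) eq
    where
    cancel : ∀ {y} → (u , right) ≡ (y , right) → l (coArc u v) ≡ l (coArc y w) → v ≡ w
    cancel refl eq' = s-injective (∙-cancelˡ (r (arc u)) (s v) (s w) eq')

  r-coArc-injective : ∀ {u u' v w} → u ∈ X → u' ∈ X → r (coArc u v) ≡ r (coArc u' w) → v ≡ w
  r-coArc-injective {u} {u'} {v} {w} u∈X u'∈X eq =
    cancel (snap {b = left} {left} u∈X u'∈X (coArc-right-near u v) (coArc-right-near u' w) eq) eq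
    where
    cancel : ∀ {y} → (u , left) ≡ (y , left) → r (coArc u v) ≡ r (coArc y w) → v ≡ w
    cancel refl eq' = s-injective (neg-injective (∙-cancelˡ (l (arc u)) (- s v) (- s w) eq'))

  l-coArc≢r-coArc : ∀ {u u'} v w → u ∈ X → u' ∈ X → l (coArc u v) ≢ r (coArc u' w)
  l-coArc≢r-coArc {u} {u'} v w u∈X u'∈X eq =
    ,right≢,left (snap u∈X u'∈X (coArc-left-near u v) (coArc-right-near u' w) eq)

module Extension {n : ℕ} (G : Graph n) (X : Subset n)
  (partner : ∀ v → v ∉ X → ∃[ u ] (u ∈ X × CircularPair G u v))
  (arc : Fin n → Arc) (distinct : DistinctEndpoints (_∈ X) arc)
  (represents : ∀ u v → u ∈ X → v ∈ X → (E G u v ⇔ Intersect (arc u) (arc v)))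
  (normalized : IsNormalized G X arc) where

  open Construction G X arc distinct represents normalized

  newArc : Fin n → Arc
  newArc v with v ∈? X
  ... | yes _   = arc v
  ... | no  v∉X = coArc (proj₁ (partner v v∉X)) v

  data Placed (v : Fin n) : Arc → Set where
    inside  : v ∈ X → Placed v (arc v)
    outside : ∀ {u} → v ∉ X → u ∈ X → CircularPair G u v → Placed v (coArc u v)

  placed : ∀ v → Placed v (newArc v)
  placed v with v ∈? X
  ... | yes v∈X = inside v∈X
  ... | no  v∉X = outside v∉X (proj₁ (proj₂ (partner v v∉X))) (proj₂ (proj₂ (partner v v∉X)))

  placed-proper : ∀ {v A} → Placed v A → l A ≢ r A
  placed-proper {v} (inside v∈X)         = proj₁ distinct v v∈X
  placed-proper {v} (outside _ u∈X _)    = l-coArc≢r-coArc v v u∈X u∈X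

  placed-distinct : ∀ {a b A B} → a ≢ b → Placed a A → Placed b B →
    (l A ≢ l B) × (r A ≢ r B) × (l A ≢ r B)
  placed-distinct {a} {b} a≢b (inside a∈X) (inside b∈X) = proj₂ distinct a b a∈X b∈X a≢b
  placed-distinct {a} {b} a≢b (inside a∈X) (outside _ u∈X _) =
    end≢l-coArc left b a∈X u∈X , end≢r-coArc right b a∈X u∈X , end≢r-coArc left b a∈X u∈X
  placed-distinct {a} {b} a≢b (outside _ u∈X _) (inside b∈X) =
    (λ eq → end≢l-coArc left a b∈X u∈X (sym eq)) ,
    (λ eq → end≢r-coArc right a b∈X u∈X (sym eq)) ,
    (λ eq → end≢l-coArc right a b∈X u∈X (sym eq))
  placed-distinct {a} {b} a≢b (outside _ u∈X _) (outside _ u'∈X _) =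
    (λ eq → a≢b (l-coArc-injective u∈X u'∈X eq)) ,
    (λ eq → a≢b (r-coArc-injective u∈X u'∈X eq)) ,
    l-coArc≢r-coArc a b u∈X u'∈X

  placed-E⇔meet : ∀ {a b A B} → (∀ x y → ¬ TrueTwins G x y) → a ≢ b → Placed a A → Placed b B →
    E G a b ⇔ Intersect A B
  placed-E⇔meet {a} {b} _ _ (inside a∈X) (inside b∈X) = represents a b a∈X b∈X
  placed-E⇔meet _ _ (inside a∈X) (outside _ u∈X cp) =
    mk⇔ (E⇒meets-coArc a∈X u∈X cp) (meets-coArc⇒E a∈X u∈X cp)
  placed-E⇔meet _ _ (outside _ u∈X cp) (inside b∈X) =
    mk⇔ (λ a∼b → meets-sym (E⇒meets-coArc b∈X u∈X cp (E-sym G a∼b)))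
        (λ meet → E-sym G (meets-coArc⇒E b∈X u∈X cp (meets-sym meet)))
  placed-E⇔meet noTwins a≢b (outside a∉X u∈X cp) (outside _ u'∈X cp') =
    mk⇔ (E⇒coArcs-meet u∈X u'∈X a≢b cp cp')
        (coArcs-meet⇒E noTwins u∈X u'∈X (λ { refl → a∉X u'∈X }) cp cp')

lemma11 : {n : ℕ} (G : Graph n) →
    (∀ u → ¬ Universal G u) →
    (∀ u v → ¬ TrueTwins G u v) →
    (X : Subset n) →
    (∀ v → v ∉ X → ∃[ u ] (u ∈ X × CircularPair G u v)) →
    (∃[ arc ] (IsCARepOf G X arc × IsNormalized G X arc)) →
    IsCircularArcGraph G
lemma11 G _ noTwins X partner (arc , (distinct , represents) , normalized) =
  newArc , ((λ v _ → placed-proper (placed v)) ,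
            (λ a b _ _ a≢b → placed-distinct a≢b (placed a) (placed b))) , E⇔meet
  where
  open Extension G X partner arc distinct represents normalized
  E⇔meet : ∀ a b → E G a b ⇔ Intersect (newArc a) (newArc b)
  E⇔meet a b with a ≟ b
  ... | yes refl = mk⇔ (λ _ → l (newArc a) , left-∈A (newArc a) , left-∈A (newArc a)) (λ _ → Graph.adj-refl G a)
  ... | no  a≢b  = placed-E⇔meet noTwins a≢b (placed a) (placed b)
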